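{- Let $k\ge 1$, $a\ge 1$, $b\ge 0$ and $c\ge 1$ be integers, let $\varphi$ be Euler's phi function, and let $$g_{k,\varphi}(n):=\frac{\prod_{i=0}^k \varphi(b+a(n+ic))}{\varphi\big(\mathrm{lcm}_{0\le i\le k}\{b+a(n+ic)\}\big)}$$ for positive integers $n$ (a periodic function). Let $P_{k,\varphi}$ be the smallest period of $g_{k,\varphi}$, and for a positive integer $n$ let $\langle n\rangle_{P_{k,\varphi}}$ be the unique integer in $[1,P_{k,\varphi}]$ congruent to $n$ modulo $P_{k,\varphi}$. Then for every positive integer $n$, $$\mathrm{lcm}_{0\le i\le k}\{\varphi(b+a(n+ic))\}\le \frac{\prod_{i=0}^k\varphi(b+a(n+ic))}{g_{k,\varphi}(\langle n\rangle_{P_{k,\varphi}})}.$$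
   Context: The smallest period of a periodic function $g$ on positive integers is the least positive integer $T$ with $g(n+T)=g(n)$ for all $n\ge 1$. -}

module Defs where

open import Data.Nat using (ℕ; zero; suc; _+_; _*_; _∸_; _≤_; _%_)
open import Data.Nat.GCD using (gcd)
open import Data.Nat.LCM using (lcm)
open import Data.Nat.Coprimality using (coprime?)
open import Data.List using (List; map; upTo; length; filter; foldr)
open import Data.Nat.ListAction using (product)
open import Data.Integer using (+_)
open import Data.Rational using (ℚ; 0ℚ; _÷_; _/_; ≢-nonZero) renaming (_≟_ to _≟ℚ_)
open import Data.Product using (_×_)
open import Relation.Binary.PropositionalEquality using (_≡_)
open import Relation.Nullary using (yes; no)

φ : ℕ → ℕ
φ n = length (filter (λ i → coprime? i n) (map suc (upTo n)))

lcmList : List ℕ → ℕ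
lcmList = foldr lcm 1

-- total division ℕ / ℕ into ℚ (only ever used with nonzero denominator)
infixl 7 _/ℕ_
_/ℕ_ : ℕ → ℕ → ℚ
m /ℕ zero  = 0ℚ
m /ℕ suc d = (+ m) / suc d

-- total division on ℚ (only ever used with nonzero denominator)
infixl 7 _÷'_
_÷'_ : ℚ → ℚ → ℚ
p ÷' q with q ≟ℚ 0ℚ
... | yes _  = 0ℚ
... | no q≢0 = _÷_ p q {{≢-nonZero q≢0}}

terms : (k a b c n : ℕ) → List ℕ
terms k a b c n = map (λ i → b + a * (n + i * c)) (upTo (suc k))

prodφ : (k a b c n : ℕ) → ℕ
prodφ k a b c n = product (map φ (terms k a b c n))

lcmφ : (k a b c n : ℕ) → ℕ
lcmφ k a b c n = lcmList (map φ (terms k a b c n))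

g : (k a b c n : ℕ) → ℚ
g k a b c n = prodφ k a b c n /ℕ φ (lcmList (terms k a b c n))

IsPeriod : (ℕ → ℚ) → ℕ → Set
IsPeriod f T = (1 ≤ T) × (∀ n → 1 ≤ n → f (n + T) ≡ f n)

IsSmallestPeriod : (ℕ → ℚ) → ℕ → Set
IsSmallestPeriod f T = IsPeriod f T × (∀ T′ → IsPeriod f T′ → T ≤ T′)

-- ⟨n⟩_P : the unique integer in [1, P] congruent to n mod P (P ≥ 1)
⟨_⟩_ : ℕ → ℕ → ℕ
⟨ n ⟩ zero  = n
⟨ n ⟩ suc p = suc ((n ∸ 1) % suc p)

module Submission where

-- Proposition 4.4.  Write xᵢ = b + a(n + ic), 0 ≤ i ≤ k.  Since P is a
-- period of g, g(⟨n⟩_P) = g(n) = ∏ φ(xᵢ) / φ(lcm xᵢ), and all these numbers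
-- are positive, so the right-hand side of the claim equals φ(lcm xᵢ).  The
-- claim therefore reduces to  lcm φ(xᵢ) ≤ φ(lcm xᵢ), which follows from the
-- divisibility  lcm φ(xᵢ) ∣ φ(lcm xᵢ), i.e. from the monotonicity of Euler's
-- function under divisibility:  d ∣ m ⇒ φ(d) ∣ φ(m).
--
-- Monotonicity is proved by counting.  Factoring m = p₁⋯p_r·d into primes it
-- suffices to show φ(d) ∣ φ(pd) for a prime p.  Among 1, …, pd exactly p·φ(d)
-- numbers are coprime to d.  Those not divisible by p are exactly the numbers
-- coprime to pd; those divisible by p are the jp (1 ≤ j ≤ d) with jp coprime
-- to d, and there are either 0 (if p ∣ d) or φ(d) (if p ∤ d) of them.  Hence
-- φ(pd) + {0 or φ(d)} = p·φ(d), and φ(d) ∣ φ(pd).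

open import Defs
open import Data.Nat using (ℕ; _≤_)
open import Data.Rational using (ℚ) renaming (_≤_ to _≤ℚ_)
import Data.Rational as ℚ
import Data.Rational.Properties as ℚP
import Data.Rational.Unnormalised as ℚᵘ
import Data.Rational.Unnormalised.Properties as ℚᵘP
import Data.Integer as ℤ
import Data.Integer.Properties as ℤP
open import Data.Nat.Tactic.RingSolver using (solve-∀)

open import Data.Nat using (zero; suc; _+_; _*_; _/_; s≤s; z≤n; >-nonZero; ≢-nonZero⁻¹; nonTrivial⇒≢1)
open import Data.Nat.Properties
open import Data.Nat.Divisibility
open import Data.Nat.DivMod using (m≡m%n+[m/n]*n)
open import Data.Nat.Coprimality using (Coprime; coprime?; coprime-+; coprime-divisor)
open import Data.Nat.Primality using (Prime; prime⇒irreducible; prime⇒nonTrivial; prime⇒nonZero)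
open import Data.Nat.Primality.Factorisation using (factorise; PrimeFactorisation)
open import Data.Nat.LCM using (lcm; lcm-least; m∣lcm[m,n]; n∣lcm[m,n]; gcd*lcm)
open import Data.Nat.GCD using (gcd)
open import Data.Nat.ListAction using (product)
open import Data.Bool using (Bool; true; false; _∧_; not)
open import Data.Bool.Properties using (∧-identityʳ; ∧-zeroʳ)
open import Data.List using (List; []; _∷_; [_]; map; upTo; length; filter; _++_)
open import Data.List.Properties using (upTo-∷ʳ; map-++; filter-++; length-++)
open import Data.List.Relation.Unary.All using (All; []; _∷_; universal)
open import Data.List.Relation.Unary.All.Properties using (map⁺)
open import Data.Product using (_×_; _,_)
open import Data.Sum using (_⊎_; inj₁; inj₂)
open import Data.Empty using (⊥-elim)
open import Function using (_∘_; mk⇔)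
open import Relation.Nullary using (¬_; yes; no; does)
open import Relation.Nullary.Decidable using (does-⇔; dec-true; dec-false; _×-dec_; ¬?)
open import Relation.Unary using (Decidable)
open import Relation.Binary.PropositionalEquality
  using (_≡_; _≢_; refl; sym; trans; cong; cong₂; subst; subst₂; module ≡-Reasoning)
open import Algebra.Properties.CommutativeSemigroup +-commutativeSemigroup using (interchange)

sumTo : (ℕ → ℕ) → ℕ → ℕ
sumTo w zero    = 0
sumTo w (suc n) = sumTo w n + w (suc n)

sumTo-cong : ∀ {v w} n → (∀ i → 1 ≤ i → i ≤ n → v i ≡ w i) → sumTo v n ≡ sumTo w n
sumTo-cong zero    _  = refl
sumTo-cong (suc n) eq = cong₂ _+_
  (sumTo-cong n (λ i 1≤i i≤n → eq i 1≤i (m≤n⇒m≤1+n i≤n)))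
  (eq (suc n) (s≤s z≤n) ≤-refl)

sumTo-+ : ∀ v w n → sumTo (λ i → v i + w i) n ≡ sumTo v n + sumTo w n
sumTo-+ v w zero    = refl
sumTo-+ v w (suc n) = trans (cong (_+ (v (suc n) + w (suc n))) (sumTo-+ v w n))
  (interchange (sumTo v n) (sumTo w n) (v (suc n)) (w (suc n)))

sumTo-vanishing : ∀ {w} n → (∀ i → 1 ≤ i → i ≤ n → w i ≡ 0) → sumTo w n ≡ 0
sumTo-vanishing zero    _  = refl
sumTo-vanishing (suc n) eq = cong₂ _+_
  (sumTo-vanishing n (λ i 1≤i i≤n → eq i 1≤i (m≤n⇒m≤1+n i≤n)))
  (eq (suc n) (s≤s z≤n) ≤-refl)

sumTo-split : ∀ w m n → sumTo w (m + n) ≡ sumTo w m + sumTo (λ i → w (m + i)) n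
sumTo-split w m zero    = trans (cong (sumTo w) (+-identityʳ m)) (sym (+-identityʳ _))
sumTo-split w m (suc n) = begin
  sumTo w (m + suc n)                                    ≡⟨ cong (sumTo w) (+-suc m n) ⟩
  sumTo w (m + n) + w (suc (m + n))                      ≡⟨ cong₂ _+_ (sumTo-split w m n) (cong w (sym (+-suc m n))) ⟩
  sumTo w m + sumTo (λ i → w (m + i)) n + w (m + suc n)  ≡⟨ +-assoc (sumTo w m) _ _ ⟩
  sumTo w m + sumTo (λ i → w (m + i)) (suc n)            ∎
  where open ≡-Reasoning

sumTo-periodic : ∀ w d → (∀ i → w (d + i) ≡ w i) → ∀ q → sumTo w (q * d) ≡ q * sumTo w d
sumTo-periodic w d per zero    = refl
sumTo-periodic w d per (suc q) = begin
  sumTo w (d + q * d)                         ≡⟨ sumTo-split w d (q * d) ⟩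
  sumTo w d + sumTo (λ i → w (d + i)) (q * d) ≡⟨ cong (sumTo w d +_) (sumTo-cong (q * d) (λ i _ _ → per i)) ⟩
  sumTo w d + sumTo w (q * d)                 ≡⟨ cong (sumTo w d +_) (sumTo-periodic w d per q) ⟩
  sumTo w d + q * sumTo w d                   ∎
  where open ≡-Reasoning

indicator : Bool → ℕ
indicator true  = 1
indicator false = 0

count : (ℕ → Bool) → ℕ → ℕ
count f = sumTo (indicator ∘ f)

length-filter-range : ∀ {P : ℕ → Set} (P? : Decidable P) n →
  length (filter P? (map suc (upTo n))) ≡ count (does ∘ P?) n
length-filter-range P? zero    = refl
length-filter-range P? (suc n) = begin
  length (filter P? (map suc (upTo (suc n))))
    ≡⟨ cong (λ l → length (filter P? (map suc l))) (sym (upTo-∷ʳ n)) ⟩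
  length (filter P? (map suc (upTo n ++ [ n ])))
    ≡⟨ cong (length ∘ filter P?) (map-++ suc (upTo n) [ n ]) ⟩
  length (filter P? (map suc (upTo n) ++ [ suc n ]))
    ≡⟨ cong length (filter-++ P? (map suc (upTo n)) [ suc n ]) ⟩
  length (filter P? (map suc (upTo n)) ++ filter P? [ suc n ])
    ≡⟨ length-++ (filter P? (map suc (upTo n))) ⟩
  length (filter P? (map suc (upTo n))) + length (filter P? [ suc n ])
    ≡⟨ cong₂ _+_ (length-filter-range P? n) (length-filter-singleton (suc n)) ⟩
  count (does ∘ P?) (suc n) ∎
  where
  open ≡-Reasoning
  length-filter-singleton : ∀ x → length (filter P? [ x ]) ≡ indicator (does (P? x))
  length-filter-singleton x with does (P? x)
  ... | true  = refl
  ... | false = refl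

count-split : ∀ (f h : ℕ → Bool) n → count f n ≡ count (λ i → f i ∧ h i) n + count (λ i → f i ∧ not (h i)) n
count-split f h n = trans (sumTo-cong {w = λ i → indicator (F i) + indicator (G i)} n
                                      (λ i _ _ → indicator-split (f i) (h i)))
                          (sumTo-+ (indicator ∘ F) (indicator ∘ G) n)
  where
  F G : ℕ → Bool
  F i = f i ∧ h i
  G i = f i ∧ not (h i)
  indicator-split : ∀ x y → indicator x ≡ indicator (x ∧ y) + indicator (x ∧ not y)
  indicator-split true  true  = refl
  indicator-split true  false = refl
  indicator-split false _     = refl

divBy : ℕ → ℕ → Bool
divBy p i = does (p ∣? i)

divBy-shift : ∀ p i → divBy p (p + i) ≡ divBy p i
divBy-shift p i = does-⇔ (mk⇔ (λ p∣p+i → ∣m+n∣m⇒∣n p∣p+i ∣-refl) (∣m∣n⇒∣m+n ∣-refl)) (p ∣? (p + i)) (p ∣? i)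

count-first-multiple : ∀ (f : ℕ → Bool) p →
  count (λ i → f i ∧ divBy (suc p) i) (suc p) ≡ indicator (f (suc p))
count-first-multiple f p = cong₂ _+_
  (sumTo-vanishing p below)
  (cong indicator (trans (cong (f (suc p) ∧_) (dec-true (suc p ∣? suc p) ∣-refl)) (∧-identityʳ _)))
  where
  below : ∀ i → 1 ≤ i → i ≤ p → indicator (f i ∧ divBy (suc p) i) ≡ 0
  below i 1≤i i≤p = cong indicator (trans
    (cong (f i ∧_) (dec-false (suc p ∣? i) (λ P∣i → <⇒≱ (s≤s i≤p) (∣⇒≤ {{>-nonZero 1≤i}} P∣i))))
    (∧-zeroʳ (f i)))

count-multiples : ∀ (f : ℕ → Bool) p d →
  count (λ i → f i ∧ divBy (suc p) i) (d * suc p) ≡ count (λ j → f (j * suc p)) d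
count-multiples f p zero    = refl
count-multiples f p (suc d) = begin
  count F (P + d * P)
    ≡⟨ sumTo-split (indicator ∘ F) P (d * P) ⟩
  count F P + count (λ i → F (P + i)) (d * P)
    ≡⟨ cong₂ _+_ (count-first-multiple f p)
                 (sumTo-cong (d * P) (λ i _ _ → cong (indicator ∘ (f (P + i) ∧_)) (divBy-shift P i))) ⟩
  indicator (f P) + count (λ i → f (P + i) ∧ divBy P i) (d * P)
    ≡⟨ cong₂ _+_ (cong (indicator ∘ f) (sym (+-identityʳ P))) (count-multiples (λ i → f (P + i)) p d) ⟩
  count (λ j → f (j * P)) 1 + count (λ j → f (P + j * P)) d
    ≡⟨ sym (sumTo-split (indicator ∘ (λ j → f (j * P))) 1 d) ⟩
  count (λ j → f (j * P)) (suc d) ∎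
  where
  open ≡-Reasoning
  P : ℕ
  P = suc p
  F : ℕ → Bool
  F i = f i ∧ divBy P i

coprimeTo : ℕ → ℕ → Bool
coprimeTo d i = does (coprime? i d)

φ-count : ∀ n → φ n ≡ count (coprimeTo n) n
φ-count n = length-filter-range (λ i → coprime? i n) n

coprimeTo-shift : ∀ d i → coprimeTo d (d + i) ≡ coprimeTo d i
coprimeTo-shift d i = does-⇔ (mk⇔ to coprime-+) (coprime? (d + i) d) (coprime? i d)
  where
  to : Coprime (d + i) d → Coprime i d
  to c (e∣i , e∣d) = c (∣m∣n⇒∣m+n e∣d e∣i , e∣d)

coprime-∣ : ∀ {m n e} → Coprime m n → e ∣ m → Coprime e n
coprime-∣ c e∣m (f∣e , f∣n) = c (∣-trans f∣e e∣m , f∣n)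

prime≢1 : ∀ {p} → Prime p → p ≢ 1
prime≢1 pp = nonTrivial⇒≢1 {{prime⇒nonTrivial pp}}

prime∤⇒coprime : ∀ {p i} → Prime p → ¬ p ∣ i → Coprime i p
prime∤⇒coprime pp p∤i (e∣i , e∣p) with prime⇒irreducible pp e∣p
... | inj₁ e≡1 = e≡1
... | inj₂ refl = ⊥-elim (p∤i e∣i)

coprimeTo-prime-product : ∀ {p} → Prime p → ∀ d i →
  coprimeTo (p * d) i ≡ coprimeTo d i ∧ not (divBy p i)
coprimeTo-prime-product {p} pp d i =
  does-⇔ (mk⇔ to from) (coprime? i (p * d)) (coprime? i d ×-dec ¬? (p ∣? i))
  where
  to : Coprime i (p * d) → Coprime i d × ¬ p ∣ i
  to c = (λ (e∣i , e∣d) → c (e∣i , ∣n⇒∣m*n p e∣d))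
       , (λ p∣i → prime≢1 pp (c (p∣i , m∣m*n d)))
  from : Coprime i d × ¬ p ∣ i → Coprime i (p * d)
  from (c , p∤i) (e∣i , e∣pd) =
    c (e∣i , coprime-divisor (coprime-∣ (prime∤⇒coprime pp p∤i) e∣i) e∣pd)

-- For p prime, the number of j ∈ [1, d] with j·p coprime to d is either
-- 0 (when p ∣ d) or φ(d) (when p ∤ d, as then j·p ⊥ d ⟺ j ⊥ d).
count-coprime-multiples : ∀ {p} → Prime p → ∀ d →
  count (λ j → coprimeTo d (j * p)) d ≡ 0 ⊎ count (λ j → coprimeTo d (j * p)) d ≡ φ d
count-coprime-multiples {p} pp d with p ∣? d
... | yes p∣d = inj₁ (sumTo-vanishing d (λ j _ _ → cong indicator
        (dec-false (coprime? (j * p) d) (λ c → prime≢1 pp (c (n∣m*n j , p∣d))))))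
... | no  p∤d = inj₂ (trans (sumTo-cong d (λ j _ _ → cong indicator (does-⇔ (mk⇔ (to j) (from j)) (coprime? (j * p) d) (coprime? j d))))
                            (sym (φ-count d)))
  where
  to : ∀ j → Coprime (j * p) d → Coprime j d
  to j c (e∣j , e∣d) = c (∣m⇒∣m*n p e∣j , e∣d)
  from : ∀ j → Coprime j d → Coprime (j * p) d
  from j c {e} (e∣jp , e∣d) =
    c (coprime-divisor (coprime-∣ (prime∤⇒coprime pp p∤d) e∣d) (subst (e ∣_) (*-comm j p) e∣jp) , e∣d)

-- Counting [1, p·d] ∩ {coprime to d} in two ways: by d-periodicity it has
-- p·φ(d) elements; split by divisibility by p, the multiples of p give the
-- count of j·p (j ≤ d) coprime to d and the non-multiples give φ(p·d).
φ-prime-multiple-identity : ∀ {p} → Prime p → ∀ d →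
  count (λ j → coprimeTo d (j * p)) d + φ (p * d) ≡ p * φ d
φ-prime-multiple-identity {zero}  pp d = ⊥-elim (≢-nonZero⁻¹ 0 {{prime⇒nonZero pp}} refl)
φ-prime-multiple-identity {suc p} pp d = begin
  count (λ j → A (j * P)) d + φ (P * d)
    ≡⟨ cong₂ _+_ (sym (trans (cong (count F) (*-comm P d)) (count-multiples A p d)))
                 (trans (φ-count (P * d))
                        (sumTo-cong (P * d) (λ i _ _ → cong indicator (coprimeTo-prime-product pp d i)))) ⟩
  count F (P * d) + count G (P * d)
    ≡⟨ sym (count-split A (divBy P) (P * d)) ⟩
  count A (P * d)
    ≡⟨ sumTo-periodic (indicator ∘ A) d (λ i → cong indicator (coprimeTo-shift d i)) P ⟩
  P * count A d
    ≡⟨ cong (P *_) (sym (φ-count d)) ⟩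
  P * φ d ∎
  where
  open ≡-Reasoning
  P : ℕ
  P = suc p
  A F G : ℕ → Bool
  A = coprimeTo d
  F i = A i ∧ divBy P i
  G i = A i ∧ not (divBy P i)

-- φ(d) ∣ φ(p·d) for p prime: by the identity above φ(d) divides
-- X + φ(p·d) where X ∈ {0, φ(d)}.
φ-∣-prime-multiple : ∀ {p} → Prime p → ∀ d → φ d ∣ φ (p * d)
φ-∣-prime-multiple {p} pp d = ∣m+n∣m⇒∣n φd∣X+φpd φd∣X
  where
  X : ℕ
  X = count (λ j → coprimeTo d (j * p)) d
  φd∣X+φpd : φ d ∣ X + φ (p * d)
  φd∣X+φpd = subst (φ d ∣_) (sym (φ-prime-multiple-identity pp d)) (n∣m*n p)
  φd∣X : φ d ∣ X
  φd∣X with count-coprime-multiples pp d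
  ... | inj₁ X≡0  = subst (φ d ∣_) (sym X≡0) (φ d ∣0)
  ... | inj₂ X≡φd = subst (φ d ∣_) (sym X≡φd) ∣-refl

φ-∣-primes-multiple : ∀ ps → All Prime ps → ∀ d → φ d ∣ φ (product ps * d)
φ-∣-primes-multiple []       []         d = subst (λ x → φ d ∣ φ x) (sym (+-identityʳ d)) ∣-refl
φ-∣-primes-multiple (p ∷ ps) (pp ∷ pps) d =
  subst (λ x → φ d ∣ φ x) reassoc (∣-trans (φ-∣-prime-multiple pp d) (φ-∣-primes-multiple ps pps (p * d)))
  where
  reassoc : product ps * (p * d) ≡ (p * product ps) * d
  reassoc = trans (sym (*-assoc (product ps) p d)) (cong (_* d) (*-comm (product ps) p))

φ-mono-∣ : ∀ {d m} → d ∣ m → φ d ∣ φ m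
φ-mono-∣ {d} (divides zero    refl) = φ d ∣0
φ-mono-∣ {d} (divides (suc q) refl) =
  subst (λ x → φ d ∣ φ (x * d)) (sym isFactorisation) (φ-∣-primes-multiple factors factorsPrime d)
  where open PrimeFactorisation (factorise (suc q))

lcmList-φ-∣ : ∀ xs → lcmList (map φ xs) ∣ φ (lcmList xs)
lcmList-φ-∣ []       = ∣-refl
lcmList-φ-∣ (x ∷ xs) = lcm-least (φ-mono-∣ (m∣lcm[m,n] x (lcmList xs)))
                                 (∣-trans (lcmList-φ-∣ xs) (φ-mono-∣ (n∣lcm[m,n] x (lcmList xs))))

φ-pos : ∀ {m} → 1 ≤ m → 1 ≤ φ m
φ-pos {suc m} _ = subst (1 ≤_) (sym (φ-count (suc m))) (begin
  1
    ≡⟨ cong indicator (sym (dec-true (coprime? 1 (suc m)) (λ (e∣1 , _) → ∣1⇒≡1 e∣1))) ⟩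
  count A 1
    ≤⟨ m≤m+n (count A 1) _ ⟩
  count A 1 + count (λ i → A (1 + i)) m
    ≡⟨ sym (sumTo-split (indicator ∘ A) 1 m) ⟩
  count A (suc m) ∎)
  where
  open ≤-Reasoning
  A : ℕ → Bool
  A = coprimeTo (suc m)

-- The lcm of two positive numbers is positive (gcd·lcm = m·n).
lcm-pos : ∀ {m n} → 1 ≤ m → 1 ≤ n → 1 ≤ lcm m n
lcm-pos {m} {n} 1≤m 1≤n = n≢0⇒n>0 λ lcm≡0 → 1≰0 (subst (1 ≤_) (m*n≡0 lcm≡0) (*-mono-≤ 1≤m 1≤n))
  where
  1≰0 : ¬ 1 ≤ 0
  1≰0 ()
  m*n≡0 : lcm m n ≡ 0 → m * n ≡ 0
  m*n≡0 l≡0 = trans (sym (gcd*lcm m n)) (trans (cong (gcd m n *_) l≡0) (*-zeroʳ (gcd m n)))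

lcmList-pos : ∀ {xs} → All (1 ≤_) xs → 1 ≤ lcmList xs
lcmList-pos []           = ≤-refl
lcmList-pos (1≤x ∷ 1≤xs) = lcm-pos 1≤x (lcmList-pos 1≤xs)

product-φ-pos : ∀ {xs} → All (1 ≤_) xs → 1 ≤ product (map φ xs)
product-φ-pos []           = ≤-refl
product-φ-pos (1≤x ∷ 1≤xs) = *-mono-≤ (φ-pos 1≤x) (product-φ-pos 1≤xs)

terms-pos : ∀ k {a} b c {n} → 1 ≤ a → 1 ≤ n → All (1 ≤_) (terms k a b c n)
terms-pos k {a} b c {n} 1≤a 1≤n = map⁺ (universal term-pos (upTo (suc k)))
  where
  term-pos : ∀ i → 1 ≤ b + a * (n + i * c)
  term-pos i = ≤-trans (*-mono-≤ 1≤a (≤-trans 1≤n (m≤m+n n (i * c)))) (m≤n+m _ b)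

period-iterate : ∀ {f : ℕ → ℚ} {T} → IsPeriod f T → ∀ q {x} → 1 ≤ x → f (x + q * T) ≡ f x
period-iterate {f} per zero {x} _ = cong f (+-identityʳ x)
period-iterate {f} {T} per@(_ , shift) (suc q) {x} 1≤x = begin
  f (x + (T + q * T)) ≡⟨ cong f (trans (cong (x +_) (+-comm T (q * T))) (sym (+-assoc x (q * T) T))) ⟩
  f (x + q * T + T)   ≡⟨ shift (x + q * T) (≤-trans 1≤x (m≤m+n x (q * T))) ⟩
  f (x + q * T)       ≡⟨ period-iterate per q 1≤x ⟩
  f x                 ∎
  where open ≡-Reasoning

period-reduce : ∀ {f : ℕ → ℚ} {T} → IsPeriod f T → ∀ {n} → 1 ≤ n → f (⟨ n ⟩ T) ≡ f n
period-reduce {T = zero}      (() , _)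
period-reduce {f} {T = suc t} per {suc m} _ = sym (trans
  (cong (f ∘ suc) (m≡m%n+[m/n]*n m (suc t)))
  (period-iterate per (m / suc t) (s≤s z≤n)))

toℚᵘ-/ : ∀ m d → ℚ.toℚᵘ ((ℤ.+ m) ℚ./ suc d) ℚᵘ.≃ ℚᵘ.mkℚᵘ (ℤ.+ m) d
toℚᵘ-/ m d = ℚP.toℚᵘ-fromℚᵘ (ℚᵘ.mkℚᵘ (ℤ.+ m) d)

/ℕ1-mono : ∀ {m n} → m ≤ n → m /ℕ 1 ≤ℚ n /ℕ 1
/ℕ1-mono {m} {n} m≤n = ℚP.toℚᵘ-cancel-≤
  (ℚᵘP.≤-respˡ-≃ (ℚᵘP.≃-sym (toℚᵘ-/ m 0)) (ℚᵘP.≤-respʳ-≃ (ℚᵘP.≃-sym (toℚᵘ-/ n 0))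
    (ℚᵘ.*≤* (subst₂ ℤ._≤_ (sym (ℤP.*-identityʳ (ℤ.+ m))) (sym (ℤP.*-identityʳ (ℤ.+ n))) (ℤ.+≤+ m≤n)))))

*-quotient : ∀ m l → (ℤ.+ suc m) ℚ./ 1 ≡ ((ℤ.+ suc l) ℚ./ 1) ℚ.* ((ℤ.+ suc m) ℚ./ suc l)
*-quotient m l = ℚP.toℚᵘ-injective (begin
  ℚ.toℚᵘ ((ℤ.+ suc m) ℚ./ 1)
    ≈⟨ toℚᵘ-/ (suc m) 0 ⟩
  ℚᵘ.mkℚᵘ (ℤ.+ suc m) 0
    ≈⟨ ℚᵘ.*≡* (cong (λ x → ℤ.+ suc x) (cross-product m l)) ⟩
  ℚᵘ.mkℚᵘ (ℤ.+ suc l) 0 ℚᵘ.* ℚᵘ.mkℚᵘ (ℤ.+ suc m) l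
    ≈⟨ ℚᵘP.≃-sym (ℚᵘP.*-cong (toℚᵘ-/ (suc l) 0) (toℚᵘ-/ (suc m) l)) ⟩
  ℚ.toℚᵘ ((ℤ.+ suc l) ℚ./ 1) ℚᵘ.* ℚ.toℚᵘ ((ℤ.+ suc m) ℚ./ suc l)
    ≈⟨ ℚᵘP.≃-sym (ℚP.toℚᵘ-homo-* ((ℤ.+ suc l) ℚ./ 1) ((ℤ.+ suc m) ℚ./ suc l)) ⟩
  ℚ.toℚᵘ (((ℤ.+ suc l) ℚ./ 1) ℚ.* ((ℤ.+ suc m) ℚ./ suc l)) ∎)
  where
  open ℚᵘP.≃-Reasoning
  -- both sides are (m + 1)(l + 1) − 1, as the cross-multiplication demands
  cross-product : ∀ m l → l + 0 * suc l + m * suc (l + 0 * suc l) ≡ (m + l * suc m) * 1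
  cross-product = solve-∀

fraction≢0 : ∀ m l → (ℤ.+ suc m) ℚ./ suc l ≢ ℚ.0ℚ
fraction≢0 m l y≡0 = ℚP.<-irrefl refl
  (subst (ℚ.0ℚ ℚ.<_) y≡0 (ℚP.positive⁻¹ _ {{ℚP.normalize-pos (suc m) (suc l)}}))

÷'-quotient : ∀ {m L} → 1 ≤ m → 1 ≤ L → (m /ℕ 1) ÷' (m /ℕ L) ≡ L /ℕ 1
÷'-quotient {suc m} {suc l} _ _ with (ℤ.+ suc m) ℚ./ suc l ℚ.≟ ℚ.0ℚ
... | yes y≡0 = ⊥-elim (fraction≢0 m l y≡0)
... | no  y≢0 = begin
  x ℚ.* ℚ.1/ y          ≡⟨ cong (ℚ._* ℚ.1/ y) (*-quotient m l) ⟩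
  (L ℚ.* y) ℚ.* ℚ.1/ y  ≡⟨ ℚP.*-assoc L y (ℚ.1/ y) ⟩
  L ℚ.* (y ℚ.* ℚ.1/ y)  ≡⟨ cong (L ℚ.*_) (ℚP.*-inverseʳ y) ⟩
  L ℚ.* ℚ.1ℚ            ≡⟨ ℚP.*-identityʳ L ⟩
  L                     ∎
  where
  open ≡-Reasoning
  x y L : ℚ
  x = (ℤ.+ suc m) ℚ./ 1
  y = (ℤ.+ suc m) ℚ./ suc l
  L = (ℤ.+ suc l) ℚ./ 1
  instance
    y-nonZero : ℚ.NonZero y
    y-nonZero = ℚ.≢-nonZero y≢0

proposition4p4 : (k a b c : ℕ) → 1 ≤ k → 1 ≤ a → 1 ≤ c →
    (P : ℕ) → IsSmallestPeriod (g k a b c) P →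
    (n : ℕ) → 1 ≤ n →
    (lcmφ k a b c n /ℕ 1) ≤ℚ ((prodφ k a b c n /ℕ 1) ÷' g k a b c (⟨ n ⟩ P))
proposition4p4 k a b c _ 1≤a _ P (period , _) n 1≤n = begin
  lcmφ k a b c n /ℕ 1
    ≤⟨ /ℕ1-mono (∣⇒≤ {{>-nonZero φL-pos}} (lcmList-φ-∣ xs)) ⟩
  φ (lcmList xs) /ℕ 1
    ≡⟨ sym (÷'-quotient (product-φ-pos xs-pos) φL-pos) ⟩
  (prodφ k a b c n /ℕ 1) ÷' g k a b c n
    ≡⟨ cong ((prodφ k a b c n /ℕ 1) ÷'_) (sym (period-reduce period 1≤n)) ⟩
  (prodφ k a b c n /ℕ 1) ÷' g k a b c (⟨ n ⟩ P) ∎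
  where
  open ℚP.≤-Reasoning
  xs : List ℕ
  xs = terms k a b c n
  xs-pos : All (1 ≤_) xs
  xs-pos = terms-pos k b c 1≤a 1≤n
  φL-pos : 1 ≤ φ (lcmList xs)
  φL-pos = φ-pos (lcmList-pos xs-pos)
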